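{- Let $A$ be an HCO matrix and let $v$ be a column vector appearing exactly $m$ times as a column of $A$. Suppose that deleting any single one of these $m$ occurrences of $v$ from $A$ produces a matrix with some pair of adjacent inharmonious columns. Then every HCO matrix whose set of distinct columns equals that of $A$ has $v$ appearing as a column at least $m$ times.
   Context: - A $0$-$1$ matrix is CO if in every row the $1$'s (if any) form a single contiguous block. - Two columns $x,y$ are inharmonious if there are rows $i,j$ with $x_i=1,y_i=0,x_j=0,y_j=1$. - A matrix is HCO if it is CO and no two adjacent columns are inharmonious. -}

module Defs where

open import Data.Bool using (Bool; true; false)
open import Data.Bool.Properties using () renaming (_≟_ to _≟ᵇ_)
open import Data.Nat using (ℕ; zero; suc; _<_)
open import Data.Fin using (Fin; toℕ)
open import Data.Vec using (Vec)
import Data.Vec as Vec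
open import Data.Vec.Properties using (≡-dec)
open import Data.List using (List; []; _∷_; length; lookup)
open import Data.List.Membership.Propositional using (_∈_)
open import Data.Product using (_×_; Σ; ∃; ∃-syntax)
open import Relation.Binary.PropositionalEquality using (_≡_)
open import Relation.Nullary using (yes; no)

-- A column of height r is a Vec Bool r (true = 1, false = 0).
Column : ℕ → Set
Column r = Vec Bool r

-- A 0-1 matrix with r rows is represented by the list of its columns, left to right.
-- (The number of columns is the length of the list.)
Matrix : ℕ → Set
Matrix r = List (Column r)

entry : ∀ {r} (A : Matrix r) → Fin (length A) → Fin r → Bool
entry A j i = Vec.lookup (lookup A j) i

-- CO: in every row the 1's form a single contiguous block, i.e. whenever
-- columns a < b < c have a 1 in row i at a and c, column b has a 1 in row i as well.
CO : ∀ {r} → Matrix r → Set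
CO {r} A = ∀ (i : Fin r) (a b c : Fin (length A)) →
  toℕ a < toℕ b → toℕ b < toℕ c →
  entry A a i ≡ true → entry A c i ≡ true → entry A b i ≡ true

Inharmonious : ∀ {r} → Column r → Column r → Set
Inharmonious {r} x y = Σ (Fin r) λ i → Σ (Fin r) λ j →
  (Vec.lookup x i ≡ true) × (Vec.lookup y i ≡ false) ×
  (Vec.lookup x j ≡ false) × (Vec.lookup y j ≡ true)

HasAdjacentInharmonious : ∀ {r} → Matrix r → Set
HasAdjacentInharmonious A = Σ (Fin (length A)) λ a → Σ (Fin (length A)) λ b →
  (toℕ b ≡ suc (toℕ a)) × Inharmonious (lookup A a) (lookup A b)

HCO : ∀ {r} → Matrix r → Set
HCO A = CO A × (HasAdjacentInharmonious A → Data.Empty.⊥)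
  where import Data.Empty

occurrences : ∀ {r} → Column r → Matrix r → ℕ
occurrences v [] = 0
occurrences v (c ∷ A) with ≡-dec _≟ᵇ_ v c
... | yes _ = suc (occurrences v A)
... | no  _ = occurrences v A

SameColumnSet : ∀ {r} → Matrix r → Matrix r → Set
SameColumnSet {r} A B = ∀ (c : Column r) → (c ∈ A → c ∈ B) × (c ∈ B → c ∈ A)

module Submission where

-- Deleting an
-- occurrence can only create the pair formed by its two neighbours x, y, so
-- x and y are inharmonious while both are harmonious with v.  Harmonious
-- columns are comparable by inclusion of supports, hence v is either a
-- "valley" (v ⊊ x, v ⊊ y) or a "peak" (x, y ⊆ v); a peak is impossible since
-- another copy of v together with the row-convexity of A would straddle a 0.
-- So every copy of v is flanked by strict supersets of v, and for each
-- ℓ = 0, …, m some strict superset of v occurs in A with exactly ℓ copies of v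
-- to its left ("label ℓ").  Two columns of A sharing a 1 in a row where v has a
-- 0 have equal labels (row-convexity).  In an HCO matrix B with the same
-- columns, the columns between two strict supersets of v with no copy of v in
-- between are again strict supersets of v and consecutive ones share such a
-- row, so they all carry the same label.  Hence sending each label to the
-- number of copies of v to the left of a B-column with that label is
-- injective, which forces m ≤ occurrences v B.

open import Data.Bool using (Bool; true; false)
open import Data.Bool.Properties using () renaming (_≟_ to _≟ᵇ_)
open import Data.Empty using (⊥; ⊥-elim; ⊥-elim-irr)
open import Data.Fin using (Fin; toℕ; fromℕ<) renaming (zero to fzero; suc to fsuc)
open import Data.Fin.Properties using (toℕ<n; toℕ-fromℕ<; toℕ-injective; injective⇒≤; all?; ¬∀⟶∃¬)
open import Data.List using (List; []; _∷_; length; lookup; removeAt; take)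
open import Data.List.Membership.Propositional using (_∈_)
open import Data.List.Relation.Unary.Any using (here; there)
open import Data.Nat using (ℕ; zero; suc; _≤_; _<_; z≤n; s≤s; s≤s⁻¹; z<s; s<s; s<s⁻¹)
open import Data.Nat.Properties
open import Data.Product using (Σ; _×_; _,_; proj₁; proj₂)
open import Data.Sum using (_⊎_; inj₁; inj₂)
import Data.Vec as Vec
open import Data.Vec.Properties using (≡-dec; tabulate∘lookup; tabulate-cong)
open import Relation.Binary using (tri<; tri≈; tri>)
open import Relation.Binary.PropositionalEquality
open import Relation.Nullary using (¬_; Dec; yes; no)
open import Relation.Nullary.Decidable using (_→-dec_)
open import Function.Definitions using (Injective)

open import Defs

private
  variable
    X : Set
    r : ℕ

-- The element at position k.  The bound is irrelevant, so equal positions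
-- denote definitionally equal elements whatever the bound proofs are.
at : (L : List X) (k : ℕ) → .(k < length L) → X
at []      k       k<0 = ⊥-elim-irr (n≮0 k<0)
at (x ∷ L) zero    _   = x
at (x ∷ L) (suc k) k<n = at L k (s<s⁻¹ k<n)

at-cong : (L : List X) {k k' : ℕ} → k ≡ k' → .(p : k < length L) .(q : k' < length L) →
  at L k p ≡ at L k' q
at-cong L refl p q = refl

lookup-fromℕ< : (L : List X) {k : ℕ} .(p : k < length L) → lookup L (fromℕ< p) ≡ at L k p
lookup-fromℕ< (x ∷ L) {zero}  p = refl
lookup-fromℕ< (x ∷ L) {suc k} p = lookup-fromℕ< L (s<s⁻¹ p)

lookup-toℕ : (L : List X) (a : Fin (length L)) → lookup L a ≡ at L (toℕ a) (toℕ<n a)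
lookup-toℕ (x ∷ L) fzero    = refl
lookup-toℕ (x ∷ L) (fsuc a) = lookup-toℕ L a

at-∈ : (L : List X) (k : ℕ) .(p : k < length L) → at L k p ∈ L
at-∈ (x ∷ L) zero    p = here refl
at-∈ (x ∷ L) (suc k) p = there (at-∈ L k (s<s⁻¹ p))

∈-at : {x : X} (L : List X) → x ∈ L → Σ ℕ λ k → Σ (k < length L) λ p → at L k p ≡ x
∈-at (y ∷ L) (here x≡y) = zero , z<s , sym x≡y
∈-at (y ∷ L) (there x∈L) with ∈-at L x∈L
... | k , p , e = suc k , s<s p , e

pred< : {k n : ℕ} → suc k < n → k < n
pred< = <-trans (n<1+n _)

AdjacentAt : (R : X → X → Set) (L : List X) (k : ℕ) → Set
AdjacentAt R L k = Σ (suc k < length L) λ p → R (at L k (pred< p)) (at L (suc k) p)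

HasAdjacent : (R : X → X → Set) (L : List X) → Set
HasAdjacent R L = Σ (Fin (length L)) λ a → Σ (Fin (length L)) λ b →
  (toℕ b ≡ suc (toℕ a)) × R (lookup L a) (lookup L b)

adjacentAt⇒has : (R : X → X → Set) (L : List X) {k : ℕ} → AdjacentAt R L k → HasAdjacent R L
adjacentAt⇒has R L (p , rel) =
  fromℕ< (pred< p) , fromℕ< p , trans (toℕ-fromℕ< p) (cong suc (sym (toℕ-fromℕ< (pred< p)))) ,
  subst₂ R (sym (lookup-fromℕ< L (pred< p))) (sym (lookup-fromℕ< L p)) rel

has⇒adjacentAt : (R : X → X → Set) (L : List X) → HasAdjacent R L → Σ ℕ (AdjacentAt R L)
has⇒adjacentAt R L (a , b , b≡1+a , rel) =
  toℕ a , p , subst₂ R (lookup-toℕ L a) (trans (lookup-toℕ L b) (at-cong L b≡1+a _ p)) rel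
  where
  p : suc (toℕ a) < length L
  p = subst (_< length L) b≡1+a (toℕ<n b)

removal-pair : (R : X → X → Set) (L : List X) (j : Fin (length L)) (k : ℕ) →
  AdjacentAt R (removeAt L j) k →
  Σ ℕ (AdjacentAt R L) ⊎
  (toℕ j ≡ suc k × Σ (suc (suc k) < length L) λ p → R (at L k (pred< (pred< p))) (at L (suc (suc k)) p))
removal-pair R (x ∷ L) fzero k (p , rel) = inj₁ (suc k , s<s p , rel)
removal-pair R (x ∷ y ∷ L) (fsuc fzero) zero (p , rel) = inj₂ (refl , s<s p , rel)
removal-pair R (x ∷ y ∷ L) (fsuc (fsuc j)) zero (p , rel) = inj₁ (zero , s<s z<s , rel)
removal-pair R (x ∷ L) (fsuc j) (suc k) (p , rel) with removal-pair R L j k (s<s⁻¹ p , rel)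
... | inj₁ (k' , q , rel') = inj₁ (suc k' , s<s q , rel')
... | inj₂ (j≡1+k , q , rel') = inj₂ (cong suc j≡1+k , s<s q , rel')

before : Column r → Matrix r → ℕ → ℕ
before v L k = occurrences v (take k L)

before-≤-occurrences : (v : Column r) (L : Matrix r) (k : ℕ) → before v L k ≤ occurrences v L
before-≤-occurrences v []      zero    = z≤n
before-≤-occurrences v []      (suc k) = z≤n
before-≤-occurrences v (c ∷ L) zero    = z≤n
before-≤-occurrences v (c ∷ L) (suc k) with ≡-dec _≟ᵇ_ v c
... | yes _ = s≤s (before-≤-occurrences v L k)
... | no  _ = before-≤-occurrences v L k

before-at-copy : (v : Column r) (L : Matrix r) (k : ℕ) (p : k < length L) →
  at L k p ≡ v → before v L (suc k) ≡ suc (before v L k)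
before-at-copy v (c ∷ L) zero p c≡v with ≡-dec _≟ᵇ_ v c
... | yes _   = refl
... | no v≢c = ⊥-elim (v≢c (sym c≡v))
before-at-copy v (c ∷ L) (suc k) p at≡v with ≡-dec _≟ᵇ_ v c
... | yes _ = cong suc (before-at-copy v L k (s<s⁻¹ p) at≡v)
... | no  _ = before-at-copy v L k (s<s⁻¹ p) at≡v

before-at-other : (v : Column r) (L : Matrix r) (k : ℕ) (p : k < length L) →
  at L k p ≢ v → before v L (suc k) ≡ before v L k
before-at-other v (c ∷ L) zero p c≢v with ≡-dec _≟ᵇ_ v c
... | yes v≡c = ⊥-elim (c≢v (sym v≡c))
... | no  _   = refl
before-at-other v (c ∷ L) (suc k) p at≢v with ≡-dec _≟ᵇ_ v c
... | yes _ = cong suc (before-at-other v L k (s<s⁻¹ p) at≢v)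
... | no  _ = before-at-other v L k (s<s⁻¹ p) at≢v

before-suc : (v : Column r) (L : Matrix r) (k : ℕ) → before v L k ≤ before v L (suc k)
before-suc v []      zero    = z≤n
before-suc v []      (suc k) = z≤n
before-suc v (c ∷ L) zero    = z≤n
before-suc v (c ∷ L) (suc k) with ≡-dec _≟ᵇ_ v c
... | yes _ = s≤s (before-suc v L k)
... | no  _ = before-suc v L k

before-mono : (v : Column r) (L : Matrix r) {k k' : ℕ} → k ≤ k' → before v L k ≤ before v L k'
before-mono v L {k} {zero}   z≤n = ≤-refl
before-mono v L {k} {suc k'} k≤1+k' with m≤n⇒m<n∨m≡n k≤1+k'
... | inj₁ k<1+k' = ≤-trans (before-mono v L (s≤s⁻¹ k<1+k')) (before-suc v L k')
... | inj₂ refl   = ≤-refl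

before-flat : (v : Column r) (L : Matrix r) {q q' : ℕ} → q ≤ q' → q' ≤ length L →
  (∀ k (p : k < length L) → q ≤ k → k < q' → at L k p ≢ v) → before v L q ≡ before v L q'
before-flat v L {q} {zero}   z≤n _ _ = refl
before-flat v L {q} {suc j} q≤1+j 1+j≤n no-copy with m≤n⇒m<n∨m≡n q≤1+j
... | inj₂ refl = refl
... | inj₁ q<1+j = trans (before-flat v L q≤j (<⇒≤ 1+j≤n)
                                       λ k p q≤k k<j → no-copy k p q≤k (m<n⇒m<1+n k<j))
                         (sym (before-at-other v L j 1+j≤n (no-copy j 1+j≤n q≤j (n<1+n j))))
  where
  q≤j = s≤s⁻¹ q<1+j

before-flat⇒other : (v : Column r) (L : Matrix r) {q k : ℕ} → q ≤ k → before v L q ≡ before v L (suc k) →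
  (p : k < length L) → at L k p ≢ v
before-flat⇒other v L {q} {k} q≤k flat p at≡v = 1+n≰n (begin
  suc (before v L k)  ≡⟨ before-at-copy v L k p at≡v ⟨
  before v L (suc k)  ≡⟨ flat ⟨
  before v L q        ≤⟨ before-mono v L q≤k ⟩
  before v L k        ∎)
  where open ≤-Reasoning

nth-copy : (v : Column r) (L : Matrix r) (ℓ : ℕ) → ℓ < occurrences v L →
  Σ ℕ λ k → Σ (k < length L) λ p → at L k p ≡ v × before v L k ≡ ℓ
nth-copy v (c ∷ L) ℓ ℓ<occ with ≡-dec _≟ᵇ_ v c
nth-copy v (c ∷ L) zero    ℓ<occ | yes v≡c = zero , z<s , sym v≡c , refl
nth-copy v (c ∷ L) (suc ℓ) ℓ<occ | yes v≡c with nth-copy v L ℓ (s<s⁻¹ ℓ<occ)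
... | k , p , at≡v , count = suc k , s<s p , at≡v , trans (before-cons-copy v≡c) (cong suc count)
  where
  before-cons-copy : v ≡ c → before v (c ∷ L) (suc k) ≡ suc (before v L k)
  before-cons-copy v≡c with ≡-dec _≟ᵇ_ v c
  ... | yes _ = refl
  ... | no v≢c = ⊥-elim (v≢c v≡c)
nth-copy v (c ∷ L) ℓ       ℓ<occ | no v≢c with nth-copy v L ℓ ℓ<occ
... | k , p , at≡v , count = suc k , s<s p , at≡v , trans before-cons-other count
  where
  before-cons-other : before v (c ∷ L) (suc k) ≡ before v L k
  before-cons-other with ≡-dec _≟ᵇ_ v c
  ... | yes v≡c = ⊥-elim (v≢c v≡c)
  ... | no _ = refl

occurs⇒∈ : (v : Column r) (L : Matrix r) → 1 ≤ occurrences v L → v ∈ L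
occurs⇒∈ v L 0<occ with nth-copy v L 0 0<occ
... | k , p , at≡v , _ = subst (_∈ L) at≡v (at-∈ L k p)

∈⇒occurs : (v : Column r) (L : Matrix r) → v ∈ L → 1 ≤ occurrences v L
∈⇒occurs v (c ∷ L) v∈L with ≡-dec _≟ᵇ_ v c | v∈L
... | yes _   | _           = s≤s z≤n
... | no v≢c | here v≡c    = ⊥-elim (v≢c v≡c)
... | no _    | there v∈L' = ∈⇒occurs v L v∈L'

_‼_ : Column r → Fin r → Bool
c ‼ t = Vec.lookup c t

true≢false : true ≢ false
true≢false ()

_⊑_ : Column r → Column r → Set
_⊑_ {r} v c = ∀ (t : Fin r) → v ‼ t ≡ true → c ‼ t ≡ true

record Escapes (v c : Column r) : Set where
  constructor escape-at
  field
    row    : Fin r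
    c-one  : c ‼ row ≡ true
    v-zero : v ‼ row ≡ false

_⊏_ : Column r → Column r → Set
v ⊏ c = v ⊑ c × Escapes v c

⊑-false : (v c : Column r) → v ⊑ c → ∀ t → c ‼ t ≡ false → v ‼ t ≡ false
⊑-false v c v⊑c t ct≡0 with v ‼ t in vt
... | false = refl
... | true  = sym (trans (sym ct≡0) (v⊑c t vt))

_⊑?_ : (v c : Column r) → Dec (v ⊑ c)
v ⊑? c = all? λ t → (v ‼ t ≟ᵇ true) →-dec (c ‼ t ≟ᵇ true)

⋢⇒escapes : (v c : Column r) → ¬ (v ⊑ c) → Escapes c v
⋢⇒escapes {r} v c v⋢c with ¬∀⟶∃¬ r _ (λ t → (v ‼ t ≟ᵇ true) →-dec (c ‼ t ≟ᵇ true)) v⋢c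
... | t , ¬[vt⇒ct] with v ‼ t in vt | c ‼ t in ct
... | true  | false = escape-at t vt ct
... | true  | true  = ⊥-elim (¬[vt⇒ct] λ _ → refl)
... | false | _     = ⊥-elim (¬[vt⇒ct] λ ())

⊑-antisym : {v c : Column r} → v ⊑ c → c ⊑ v → v ≡ c
⊑-antisym {v = v} {c} v⊑c c⊑v = begin
  v                         ≡⟨ tabulate∘lookup v ⟨
  Vec.tabulate (Vec.lookup v) ≡⟨ tabulate-cong same-entry ⟩
  Vec.tabulate (Vec.lookup c) ≡⟨ tabulate∘lookup c ⟩
  c                         ∎
  where
  open ≡-Reasoning
  same-entry : ∀ t → v ‼ t ≡ c ‼ t
  same-entry t with v ‼ t in vt | c ‼ t in ct
  ... | true  | true  = refl
  ... | false | false = refl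
  ... | true  | false = trans (sym (v⊑c t vt)) ct
  ... | false | true  = trans (sym vt) (c⊑v t ct)

⊑-≢⇒⊏ : {v c : Column r} → v ⊑ c → c ≢ v → v ⊏ c
⊑-≢⇒⊏ {v = v} {c} v⊑c c≢v with c ⊑? v
... | yes c⊑v = ⊥-elim (c≢v (sym (⊑-antisym v⊑c c⊑v)))
... | no  c⋢v = v⊑c , ⋢⇒escapes c v c⋢v

harmonious⇒comparable : (x y : Column r) → ¬ Inharmonious x y → x ⊑ y ⊎ y ⊑ x
harmonious⇒comparable x y harmonious with x ⊑? y
... | yes x⊑y = inj₁ x⊑y
... | no  x⋢y with y ⊑? x
...   | yes y⊑x = inj₂ y⊑x
...   | no  y⋢x with ⋢⇒escapes x y x⋢y | ⋢⇒escapes y x y⋢x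
...     | escape-at i xi yi | escape-at j yj xj = ⊥-elim (harmonious (i , j , xi , yi , xj , yj))

valley-or-peak : (x w y : Column r) → ¬ Inharmonious x w → ¬ Inharmonious w y → Inharmonious x y →
  (w ⊏ x × w ⊏ y) ⊎ (Escapes y w × Escapes x w)
valley-or-peak x w y xw wy (i , j , xi , yi , xj , yj)
  with harmonious⇒comparable x w xw | harmonious⇒comparable w y wy
... | inj₁ x⊑w | inj₁ w⊑y = ⊥-elim (true≢false (trans (sym (w⊑y i (x⊑w i xi))) yi))
... | inj₁ x⊑w | inj₂ y⊑w = inj₂ (escape-at i (x⊑w i xi) yi , escape-at j (y⊑w j yj) xj)
... | inj₂ w⊑x | inj₁ w⊑y = inj₁ ((w⊑x , escape-at i xi (⊑-false w y w⊑y i yi)) ,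
                                (w⊑y , escape-at j yj (⊑-false w x w⊑x j xj)))
... | inj₂ w⊑x | inj₂ y⊑w = ⊥-elim (true≢false (trans (sym (w⊑x j (y⊑w j yj))) xj))

record ShareEscape (v c d : Column r) : Set where
  constructor share-at
  field
    row    : Fin r
    c-one  : c ‼ row ≡ true
    d-one  : d ‼ row ≡ true
    v-zero : v ‼ row ≡ false

share-sym : {v c d : Column r} → ShareEscape v c d → ShareEscape v d c
share-sym (share-at t ct dt vt) = share-at t dt ct vt

self-share : {v c : Column r} → v ⊏ c → ShareEscape v c c
self-share (_ , escape-at t ct vt) = share-at t ct ct vt

escape-together : {v c d : Column r} → Escapes v c → Escapes v d → ¬ Inharmonious c d → ShareEscape v c d
escape-together {c = c} {d} (escape-at s cs vs) (escape-at t dt vt) harmonious with d ‼ s in ds | c ‼ t in ct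
... | true  | _     = share-at s cs ds vs
... | false | true  = share-at t ct dt vt
... | false | false = ⊥-elim (harmonious (s , t , cs , ds , ct , dt))

row-convex : (L : Matrix r) → CO L → ∀ t {a b c : ℕ}
  (pa : a < length L) (pb : b < length L) (pc : c < length L) → a ≤ b → b ≤ c →
  at L a pa ‼ t ≡ true → at L c pc ‼ t ≡ true → at L b pb ‼ t ≡ true
row-convex L co t pa pb pc a≤b b≤c la lc with m≤n⇒m<n∨m≡n a≤b | m≤n⇒m<n∨m≡n b≤c
... | inj₂ refl | _         = la
... | inj₁ _    | inj₂ refl = lc
... | inj₁ a<b  | inj₁ b<c  = subst (λ col → col ‼ t ≡ true) (lookup-fromℕ< L pb)
  (co t (fromℕ< pa) (fromℕ< pb) (fromℕ< pc) (index< pa pb a<b) (index< pb pc b<c)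
        (entry-at pa la) (entry-at pc lc))
  where
  index< : ∀ {k k'} (p : k < length L) (p' : k' < length L) → k < k' → toℕ (fromℕ< p) < toℕ (fromℕ< p')
  index< p p' = subst₂ _<_ (sym (toℕ-fromℕ< p)) (sym (toℕ-fromℕ< p'))
  entry-at : ∀ {k} (p : k < length L) → at L k p ‼ t ≡ true → entry L (fromℕ< p) t ≡ true
  entry-at p = subst (λ col → col ‼ t ≡ true) (sym (lookup-fromℕ< L p))

adjacent-harmonious : (L : Matrix r) → ¬ HasAdjacentInharmonious L →
  ∀ {k} (p : suc k < length L) → ¬ Inharmonious (at L k (pred< p)) (at L (suc k) p)
adjacent-harmonious L no-pair p inh = no-pair (adjacentAt⇒has Inharmonious L (p , inh))

module EssentialCopies {r : ℕ} (A : Matrix r) (v : Column r)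
  (coA : CO A) (harmoniousA : ¬ HasAdjacentInharmonious A)
  (essential : ∀ (j : Fin (length A)) → lookup A j ≡ v → HasAdjacentInharmonious (removeAt A j))
  (two-copies : 2 ≤ occurrences v A) where

  -- the copy of v at position suc k lies between two strict supersets of v
  record Valley (k : ℕ) : Set where
    field
      bound : suc (suc k) < length A
      left  : v ⊏ at A k (pred< (pred< bound))
      right : v ⊏ at A (suc (suc k)) bound

  -- Deleting a copy of v can only create the pair of its two neighbours.
  neighbours-inharmonious : ∀ {n} (p : n < length A) → at A n p ≡ v →
    Σ ℕ λ k → suc k ≡ n × Σ (suc (suc k) < length A) λ q →
      Inharmonious (at A k (pred< (pred< q))) (at A (suc (suc k)) q)
  neighbours-inharmonious p at≡v
    with has⇒adjacentAt Inharmonious (removeAt A (fromℕ< p)) (essential (fromℕ< p) (trans (lookup-fromℕ< A p) at≡v))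
  ... | k , new-pair with removal-pair Inharmonious A (fromℕ< p) k new-pair
  ...   | inj₁ (_ , old-pair)    = ⊥-elim (harmoniousA (adjacentAt⇒has Inharmonious A old-pair))
  ...   | inj₂ (j≡1+k , q , inh) = k , trans (sym j≡1+k) (toℕ-fromℕ< p) , q , inh

  another-copy : ∀ n → Σ ℕ λ n' → Σ (n' < length A) λ p' → at A n' p' ≡ v × n' ≢ n
  another-copy n with nth-copy v A 0 (≤-trans (s≤s z≤n) two-copies) | nth-copy v A 1 two-copies
  ... | k₀ , p₀ , at₀≡v , count₀ | k₁ , p₁ , at₁≡v , count₁ with k₀ ≟ n
  ...   | no k₀≢n  = k₀ , p₀ , at₀≡v , k₀≢n
  ...   | yes refl = k₁ , p₁ , at₁≡v , λ k₁≡k₀ →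
          0≢1+n (trans (sym count₀) (trans (cong (before v A) (sym k₁≡k₀)) count₁))

  -- A copy of v with inharmonious neighbours is a valley: were it a peak, the
  -- other copy of v would lie beyond one neighbour, which has a 0 where v has a 1.
  valley-between : ∀ k (q : suc (suc k) < length A) → at A (suc k) (pred< q) ≡ v →
    Inharmonious (at A k (pred< (pred< q))) (at A (suc (suc k)) q) → Valley k
  valley-between k q at≡v inh = from-shape (valley-or-peak x v y harmonious-left harmonious-right inh)
    where
    x = at A k (pred< (pred< q))
    y = at A (suc (suc k)) q
    harmonious-left : ¬ Inharmonious x v
    harmonious-left = subst (λ w → ¬ Inharmonious x w) at≡v (adjacent-harmonious A harmoniousA (pred< q))
    harmonious-right : ¬ Inharmonious v y
    harmonious-right = subst (λ w → ¬ Inharmonious w y) at≡v (adjacent-harmonious A harmoniousA q)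
    on-copy : ∀ {n t} (p : n < length A) → at A n p ≡ v → v ‼ t ≡ true → at A n p ‼ t ≡ true
    on-copy p at≡v vt = trans (cong (_‼ _) at≡v) vt
    no-peak : Escapes y v × Escapes x v → ⊥
    no-peak (escape-at i vi yi , escape-at j vj xj) with another-copy (suc k)
    ... | n' , p' , at'≡v , n'≢n with <-cmp n' (suc k)
    ...   | tri≈ _ n'≡n _ = n'≢n n'≡n
    ...   | tri> _ _ n<n' = true≢false (trans (sym y-one) yi)
      where
      y-one : y ‼ i ≡ true
      y-one = row-convex A coA i (pred< q) q p' (n≤1+n _) n<n'
                (on-copy (pred< q) at≡v vi) (on-copy p' at'≡v vi)
    ...   | tri< n'<n _ _ = true≢false (trans (sym x-one) xj)
      where
      x-one : x ‼ j ≡ true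
      x-one = row-convex A coA j p' (pred< (pred< q)) (pred< q) (s≤s⁻¹ n'<n) (n≤1+n k)
                (on-copy p' at'≡v vj) (on-copy (pred< q) at≡v vj)
    from-shape : (v ⊏ x × v ⊏ y) ⊎ (Escapes y v × Escapes x v) → Valley k
    from-shape (inj₁ (v⊏x , v⊏y)) = record { bound = q ; left = v⊏x ; right = v⊏y }
    from-shape (inj₂ peak)        = ⊥-elim (no-peak peak)

  copy-is-valley : ∀ {n} (p : n < length A) → at A n p ≡ v → Σ ℕ λ k → suc k ≡ n × Valley k
  copy-is-valley p at≡v with neighbours-inharmonious p at≡v
  ... | k , refl , q , inh = k , refl , valley-between k q at≡v inh

  Labelled : ℕ → Column r → Set
  Labelled ℓ c = Σ ℕ λ q → Σ (q < length A) λ p → at A q p ≡ c × before v A q ≡ ℓ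

  -- Row-convexity: columns of A with a 1 in a common row where v has a 0
  -- have no copy of v between them.
  shared-row⇒same-count : ∀ {q q'} (p : q < length A) (p' : q' < length A) → q ≤ q' →
    ShareEscape v (at A q p) (at A q' p') → before v A q ≡ before v A q'
  shared-row⇒same-count p p' q≤q' (share-at t ct dt vt) = before-flat v A q≤q' (<⇒≤ p') no-copy
    where
    no-copy : ∀ k (pk : k < length A) → _ ≤ k → k < _ → at A k pk ≢ v
    no-copy k pk q≤k k<q' at≡v = true≢false (trans (sym
      (trans (cong (_‼ t) (sym at≡v)) (row-convex A coA t p pk p' q≤k (<⇒≤ k<q') ct dt))) vt)

  label-unique : ∀ {ℓ ℓ' c d} → Labelled ℓ c → Labelled ℓ' d → ShareEscape v c d → ℓ ≡ ℓ'
  label-unique (q , p , at≡c , count) (q' , p' , at≡d , count') share with ≤-total q q'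
  ... | inj₁ q≤q' = trans (sym count) (trans (shared-row⇒same-count p p' q≤q' shared) count')
    where shared = subst₂ (ShareEscape v) (sym at≡c) (sym at≡d) share
  ... | inj₂ q'≤q = trans (sym count) (trans (sym (shared-row⇒same-count p' p q'≤q shared)) count')
    where shared = subst₂ (ShareEscape v) (sym at≡d) (sym at≡c) (share-sym share)

  -- The neighbours of the valleys realise every label 0, …, occurrences v A.
  superset-with-label : ∀ ℓ → ℓ ≤ occurrences v A → Σ (Column r) λ c → v ⊏ c × Labelled ℓ c
  superset-with-label zero _ with nth-copy v A 0 (≤-trans (s≤s z≤n) two-copies)
  ... | n , p , at≡v , count with copy-is-valley p at≡v
  ...   | k , refl , valley = _ , left , k , pred< (pred< bound) , refl ,
          n≤0⇒n≡0 (≤-trans (before-mono v A (n≤1+n k)) (≤-reflexive count))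
    where open Valley valley
  superset-with-label (suc ℓ) ℓ<occ with nth-copy v A ℓ ℓ<occ
  ... | n , p , at≡v , count with copy-is-valley p at≡v
  ...   | k , refl , valley = _ , right , suc n , bound , refl ,
          trans (before-at-copy v A n p at≡v) (cong suc count)
    where open Valley valley

  module InB (B : Matrix r) (coB : CO B) (harmoniousB : ¬ HasAdjacentInharmonious B)
    (same : SameColumnSet A B) where

    label-of : ∀ (c : Column r) → c ∈ B → Σ ℕ λ ℓ → Labelled ℓ c
    label-of c c∈B with ∈-at A (proj₂ (same c) c∈B)
    ... | q , p , at≡c = before v A q , q , p , at≡c , refl

    -- Between strict supersets of v at positions b ≤ b' of B with no copy of v
    -- in between, every column is a strict superset of v, consecutive ones
    -- share a row escaping v, and so the label does not change.
    constant-label : ∀ {ℓ ℓ'} b b' (pb : b < length B) (pb' : b' < length B) → b ≤ b' →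
      v ⊏ at B b pb → v ⊏ at B b' pb' → before v B b ≡ before v B b' →
      Labelled ℓ (at B b pb) → Labelled ℓ' (at B b' pb') → ℓ ≡ ℓ'
    constant-label zero zero pb pb' z≤n v⊏b _ _ lb lb' = label-unique lb lb' (self-share v⊏b)
    constant-label b (suc j) pb pb' b≤b' v⊏b v⊏b' flat lb lb' with m≤n⇒m<n∨m≡n b≤b'
    ... | inj₂ refl = label-unique lb lb' (self-share v⊏b)
    ... | inj₁ b<b' = trans (constant-label b j pb pj b≤j v⊏b v⊏j flat-to-j lb (proj₂ label-j))
                            (label-unique (proj₂ label-j) lb' share)
      where
      b≤j = s≤s⁻¹ b<b'
      pj = pred< pb'
      v⊑j : v ⊑ at B j pj
      v⊑j t vt = row-convex B coB t pb pj pb' b≤j (n≤1+n j) (proj₁ v⊏b t vt) (proj₁ v⊏b' t vt)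
      v⊏j : v ⊏ at B j pj
      v⊏j = ⊑-≢⇒⊏ v⊑j (before-flat⇒other v B b≤j flat pj)
      flat-to-j : before v B b ≡ before v B j
      flat-to-j = ≤-antisym (before-mono v B b≤j) (≤-trans (before-suc v B j) (≤-reflexive (sym flat)))
      label-j = label-of (at B j pj) (at-∈ B j pj)
      share = escape-together (proj₂ v⊏j) (proj₂ v⊏b') (adjacent-harmonious B harmoniousB pb')

    equal-counts⇒equal-labels : ∀ {ℓ ℓ'} b b' (pb : b < length B) (pb' : b' < length B) →
      v ⊏ at B b pb → v ⊏ at B b' pb' → Labelled ℓ (at B b pb) → Labelled ℓ' (at B b' pb') →
      before v B b ≡ before v B b' → ℓ ≡ ℓ'
    equal-counts⇒equal-labels b b' pb pb' v⊏b v⊏b' lb lb' flat with ≤-total b b'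
    ... | inj₁ b≤b' = constant-label b b' pb pb' b≤b' v⊏b v⊏b' flat lb lb'
    ... | inj₂ b'≤b = sym (constant-label b' b pb' pb b'≤b v⊏b' v⊏b (sym flat) lb' lb)

    record Witness (ℓ : ℕ) : Set where
      field
        position : ℕ
        bound    : position < length B
        superset : v ⊏ at B position bound
        labelled : Labelled ℓ (at B position bound)

    witness : ∀ ℓ → ℓ ≤ occurrences v A → Witness ℓ
    witness ℓ ℓ≤occ with superset-with-label ℓ ℓ≤occ
    ... | c , v⊏c , labelled@(q , p , at≡c , _)
      with ∈-at B (proj₁ (same c) (subst (_∈ A) at≡c (at-∈ A q p)))
    ...   | b , pb , atB≡c = record
      { position = b ; bound = pb
      ; superset = subst (v ⊏_) (sym atB≡c) v⊏c
      ; labelled = subst (Labelled ℓ) (sym atB≡c) labelled }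

    witness-of : (ℓ : Fin (suc (occurrences v A))) → Witness (toℕ ℓ)
    witness-of ℓ = witness (toℕ ℓ) (s≤s⁻¹ (toℕ<n ℓ))

    count-of-label : Fin (suc (occurrences v A)) → Fin (suc (occurrences v B))
    count-of-label ℓ = fromℕ< (s≤s (before-≤-occurrences v B (Witness.position (witness-of ℓ))))

    count-of-label-injective : Injective _≡_ _≡_ count-of-label
    count-of-label-injective {ℓ} {ℓ'} same-count = toℕ-injective
      (equal-counts⇒equal-labels (position w) (position w') (bound w) (bound w')
        (superset w) (superset w') (labelled w) (labelled w') same-before)
      where
      open Witness
      w  = witness-of ℓ
      w' = witness-of ℓ'
      same-before : before v B (position w) ≡ before v B (position w')
      same-before = begin
        before v B (position w)        ≡⟨ toℕ-fromℕ< _ ⟨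
        toℕ (count-of-label ℓ)         ≡⟨ cong toℕ same-count ⟩
        toℕ (count-of-label ℓ')        ≡⟨ toℕ-fromℕ< _ ⟩
        before v B (position w')       ∎
        where open ≡-Reasoning

    rigidity : occurrences v A ≤ occurrences v B
    rigidity = s≤s⁻¹ (injective⇒≤ count-of-label-injective)

lemma4p2 : ∀ {r : ℕ} (A : Matrix r) (v : Column r) (m : ℕ) →
    HCO A →
    occurrences v A ≡ m →
    (∀ (j : Fin (length A)) → lookup A j ≡ v →
      HasAdjacentInharmonious (removeAt A j)) →
    ∀ (B : Matrix r) → HCO B → SameColumnSet A B →
    m ≤ occurrences v B
-- No copies: nothing to show.
lemma4p2 A v zero _ _ _ B _ _ = z≤n
lemma4p2 A v (suc zero) _ one-copy _ B _ same =
  ∈⇒occurs v B (proj₁ (same v) (occurs⇒∈ v A (≤-reflexive (sym one-copy))))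
lemma4p2 A v (suc (suc m)) (coA , harmoniousA) copies essential B (coB , harmoniousB) same =
  subst (_≤ occurrences v B) copies (InB.rigidity B coB harmoniousB same)
  where
  open EssentialCopies A v coA harmoniousA essential (≤-trans (s≤s (s≤s z≤n)) (≤-reflexive (sym copies)))
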